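{- Let $f$ be a comparator network of order $n$ that is a selection network for parameter $k$ ($1\le k\le n$), with half encoding $\phi(f)$, input variables $x_1,\dots,x_n$ and output variables $y_1,\dots,y_n$. Assume exactly $k-1$ input variables are set to true and all other variables are undefined. Then unit propagation on $\phi(f)$ sets $y_1,\dots,y_{k-1}$ to true.
   Context: A comparator $c_{i,j}$ ($i<j$) on $\mathbb N^n$ puts the maximum of the entries at positions $i,j$ into position $i$ and the minimum into position $j$; a comparator network of order $n$ is a finite sequence of comparators applied in order. $f$ is a selection network for $k$ if for every $\bar x\in\mathbb N^n$, $f(\bar x)$ satisfies $y_1\ge\dots\ge y_k$ and $y_i\ge y_j$ for all $i\le k<j$. Half encoding: wire position $i$ initially carries the boolean variable $x_i$; processing comparators in order, a comparator $c_{i,j}$ with current variables $a,b$ at positions $i,j$ introduces fresh variables $c,d$ that become the current variables at positions $i,j$, with clauses $(\neg a\vee c)\wedge(\neg b\vee c)\wedge(\neg a\vee\neg b\vee d)$; $y_1,\dots,y_n$ are the final current variables, and $\phi(f)$ is the conjunction of all clauses. Variables are true (1), false (0) or undefined. Unit propagation repeatedly sets to true the single undefined literal of any clause whose other literals are all false, until a fixpoint. -}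

module Defs where

open import Data.Nat using (ℕ; zero; suc; _≤_; _<_; _⊔_; _⊓_)
open import Data.Fin using (Fin; toℕ)
import Data.Fin as F
open import Data.Vec using (Vec; lookup; tabulate; _[_]≔_)
open import Data.List using (List; []; _∷_; _++_)
open import Data.List.Membership.Propositional using (_∈_)
open import Data.Product using (_×_; _,_; proj₁; proj₂)
open import Relation.Binary.PropositionalEquality using (_≡_; _≢_)
open import Relation.Nullary using (¬_)

record Comparator (n : ℕ) : Set where
  constructor comp
  field
    i j : Fin n
    i<j : i F.< j

open Comparator public

Network : ℕ → Set
Network n = List (Comparator n)

applyComp : ∀ {n} → Comparator n → Vec ℕ n → Vec ℕ n
applyComp c v =
  let a = lookup v (i c) ; b = lookup v (j c)
  in (v [ i c ]≔ (a ⊔ b)) [ j c ]≔ (a ⊓ b)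

run : ∀ {n} → Network n → Vec ℕ n → Vec ℕ n
run []       v = v
run (c ∷ cs) v = run cs (applyComp c v)

-- f is a selection network for k (0-indexed: y_1..y_k are positions < k)
IsSelectionNetwork : ∀ {n} → ℕ → Network n → Set
IsSelectionNetwork {n} k f = (x : Vec ℕ n) →
  let y = run f x in
    (∀ (a b : Fin n) → a F.< b → toℕ b < k → lookup y b ≤ lookup y a)
  × (∀ (a b : Fin n) → toℕ a < k → k ≤ toℕ b → lookup y b ≤ lookup y a)

data Lit : Set where
  pos : ℕ → Lit
  neg : ℕ → Lit

negate : Lit → Lit
negate (pos x) = neg x
negate (neg x) = pos x

Clause : Set
Clause = List Lit

CNF : Set
CNF = List Clause

-- Half encoding.  Input variable x_i is the number toℕ i; fresh variables
-- are allocated from n upward.  State: current variables, next fresh var.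

encodeComp : ∀ {n} → Comparator n → Vec ℕ n × ℕ → (Vec ℕ n × ℕ) × CNF
encodeComp cmp (v , fr) =
  let a = lookup v (i cmp) ; b = lookup v (j cmp)
      c = fr ; d = suc fr
  in ((v [ i cmp ]≔ c) [ j cmp ]≔ d , suc (suc fr))
   , ((neg a ∷ pos c ∷ []) ∷ (neg b ∷ pos c ∷ []) ∷ (neg a ∷ neg b ∷ pos d ∷ []) ∷ [])

encodeFrom : ∀ {n} → Network n → Vec ℕ n × ℕ → (Vec ℕ n × ℕ) × CNF
encodeFrom []         s = s , []
encodeFrom (cmp ∷ cs) s =
  let r₁ = encodeComp cmp s ; r₂ = encodeFrom cs (proj₁ r₁)
  in proj₁ r₂ , (proj₂ r₁ ++ proj₂ r₂)

initState : ∀ {n} → Vec ℕ n × ℕ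
initState {n} = tabulate toℕ , n

xVar : ∀ {n} → Fin n → ℕ
xVar a = toℕ a

φ : ∀ {n} → Network n → CNF
φ f = proj₂ (encodeFrom f initState)

yVar : ∀ {n} → Network n → Fin n → ℕ
yVar f a = lookup (proj₁ (proj₁ (encodeFrom f initState))) a

-- Unit propagation: the set of literals made true, starting from the
-- initially true literals I, as the least set closed under the unit rule:
-- if every literal of a clause other than l is false (its negation is
-- true), then l becomes true.

data UnitProp (ψ : CNF) (I : Lit → Set) : Lit → Set where
  initial : ∀ {l} → I l → UnitProp ψ I l
  unit    : ∀ {C l} → C ∈ ψ → l ∈ C →
            (∀ {l′} → l′ ∈ C → l′ ≢ l → UnitProp ψ I (negate l′)) →
            UnitProp ψ I l

InitTrue : ∀ {n} → (Fin n → Set) → Lit → Set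
InitTrue {n} S l = Data.Product.Σ (Fin n) (λ a → S a × l ≡ pos (xVar a))

-- Run f on the 0/1 vector with ones exactly on S.  By induction along the network, every
-- wire that carries a 1 holds a variable forced true by unit propagation: the clauses
-- ¬a ∨ c, ¬b ∨ c propagate the maximum and ¬a ∨ ¬b ∨ d the minimum.  Comparators preserve
-- the sum, so the output also has k − 1 ones, and a selection network puts them at the
-- top: a 0 at a position a < k − 1 would force zeros at every later position, leaving at
-- most a ones in total.
module Submission where

open import Defs
open import Data.Nat using (ℕ; _≤_; _<_; _∸_)
open import Data.Fin using (Fin; toℕ)
open import Data.Fin.Subset using (Subset; _∈_; ∣_∣)
open import Relation.Binary.PropositionalEquality using (_≡_)

open import Data.Nat using (zero; suc; _+_; _⊔_; _⊓_; z≤n; s≤s; _<?_)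
open import Data.Nat.Properties
open import Data.Fin as F using ()
open import Data.Fin.Properties using (toℕ-injective) renaming (_≟_ to _≟ᶠ_)
open import Data.Bool using (Bool; true; false)
open import Data.Vec using (Vec; []; _∷_; lookup; map; sum; _[_]≔_)
open import Data.Vec.Properties using (lookup∘update; lookup∘update′; lookup-map; lookup∘tabulate; lookup⇒[]=)
open import Data.Vec.Functional.Relation.Binary.Pointwise using (Pointwise)
open import Data.Vec.Functional.Relation.Unary.All using (All)
open import Data.List using ([]; _∷_)
open import Data.List.Membership.Propositional using () renaming (_∈_ to _∈ₗ_)
open import Data.List.Relation.Unary.Any using (here; there)
open import Data.Product using (_×_; _,_; proj₁; proj₂)
open import Data.Sum using (inj₁; inj₂)
open import Relation.Binary.PropositionalEquality
  using (refl; sym; trans; cong; subst; subst₂; _≢_; module ≡-Reasoning)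
open import Relation.Nullary using (yes; no; contradiction)
open import Algebra.Properties.CommutativeSemigroup +-commutativeSemigroup using (xy∙z≈xz∙y; xy∙z≈zy∙x)

[]≔-pointwise : ∀ {A B : Set} {n} (R : A → B → Set) (xs : Vec A n) (ys : Vec B n) {x y} i →
                Pointwise R (lookup xs) (lookup ys) → R x y →
                Pointwise R (lookup (xs [ i ]≔ x)) (lookup (ys [ i ]≔ y))
[]≔-pointwise R xs ys {x} {y} i rs r p with i ≟ᶠ p
... | yes refl = subst₂ R (sym (lookup∘update i xs x)) (sym (lookup∘update i ys y)) r
... | no i≢p   = subst₂ R (sym (lookup∘update′ p≢i xs x)) (sym (lookup∘update′ p≢i ys y)) (rs p)
  where
    p≢i : p ≢ i
    p≢i p≡i = i≢p (sym p≡i)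

[]≔-all : ∀ {A : Set} {n} (P : A → Set) (xs : Vec A n) {x} i →
          All P (lookup xs) → P x → All P (lookup (xs [ i ]≔ x))
[]≔-all P xs {x} i = []≔-pointwise (λ a _ → P a) xs xs {x} {x} i

sum-[]≔ : ∀ {n} (xs : Vec ℕ n) i x → sum (xs [ i ]≔ x) + lookup xs i ≡ sum xs + x
sum-[]≔ (y ∷ xs) F.zero    x = xy∙z≈zy∙x x (sum xs) y
sum-[]≔ (y ∷ xs) (F.suc i) x = begin
  y + sum (xs [ i ]≔ x) + lookup xs i   ≡⟨ +-assoc y _ _ ⟩
  y + (sum (xs [ i ]≔ x) + lookup xs i) ≡⟨ cong (y +_) (sum-[]≔ xs i x) ⟩
  y + (sum xs + x)                      ≡⟨ +-assoc y (sum xs) x ⟨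
  y + sum xs + x                        ∎
  where open ≡-Reasoning

m⊔n+m⊓n≡m+n : ∀ m n → (m ⊔ n) + (m ⊓ n) ≡ m + n
m⊔n+m⊓n≡m+n m n with ≤-total m n
... | inj₁ m≤n rewrite m≤n⇒m⊔n≡n m≤n | m≤n⇒m⊓n≡m m≤n = +-comm n m
... | inj₂ n≤m rewrite m≥n⇒m⊔n≡m n≤m | m≥n⇒m⊓n≡n n≤m = refl

i≢j : ∀ {n} (c : Comparator n) → i c ≢ j c
i≢j c i≡j = <-irrefl (cong toℕ i≡j) (i<j c)

sum-applyComp : ∀ {n} (c : Comparator n) (v : Vec ℕ n) → sum (applyComp c v) ≡ sum v
sum-applyComp c v = +-cancelʳ-≡ (a + b) (sum u) (sum v) (begin
  sum u + (a + b)             ≡⟨ cong (sum u +_) (+-comm a b) ⟩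
  sum u + (b + a)             ≡⟨ +-assoc (sum u) b a ⟨
  sum u + b + a               ≡⟨ cong (_+ a) sum-u ⟩
  sum w + (a ⊓ b) + a         ≡⟨ xy∙z≈xz∙y (sum w) (a ⊓ b) a ⟩
  sum w + a + (a ⊓ b)         ≡⟨ cong (_+ (a ⊓ b)) (sum-[]≔ v (i c) (a ⊔ b)) ⟩
  sum v + (a ⊔ b) + (a ⊓ b)   ≡⟨ +-assoc (sum v) (a ⊔ b) (a ⊓ b) ⟩
  sum v + ((a ⊔ b) + (a ⊓ b)) ≡⟨ cong (sum v +_) (m⊔n+m⊓n≡m+n a b) ⟩
  sum v + (a + b)             ∎)
  where
    open ≡-Reasoning
    a = lookup v (i c)
    b = lookup v (j c)
    w = v [ i c ]≔ (a ⊔ b)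
    u = w [ j c ]≔ (a ⊓ b)
    sum-u : sum u + b ≡ sum w + (a ⊓ b)
    sum-u = subst (λ z → sum u + z ≡ sum w + (a ⊓ b))
                  (lookup∘update′ (λ j≡i → i≢j c (sym j≡i)) v (a ⊔ b))
                  (sum-[]≔ w (j c) (a ⊓ b))

sum-run : ∀ {n} (f : Network n) (v : Vec ℕ n) → sum (run f v) ≡ sum v
sum-run []       v = refl
sum-run (c ∷ cs) v = trans (sum-run cs (applyComp c v)) (sum-applyComp c v)

ZeroOne : ∀ {n} → Vec ℕ n → Set
ZeroOne v = All (_≤ 1) (lookup v)

applyComp-zeroOne : ∀ {n} (c : Comparator n) (v : Vec ℕ n) → ZeroOne v → ZeroOne (applyComp c v)
applyComp-zeroOne c v v≤1 =
  []≔-all (_≤ 1) (v [ i c ]≔ (a ⊔ b)) (j c)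
    ([]≔-all (_≤ 1) v (i c) v≤1 (⊔-lub (v≤1 (i c)) (v≤1 (j c))))
    (≤-trans (m⊓n≤m a b) (v≤1 (i c)))
  where
    a = lookup v (i c)
    b = lookup v (j c)

run-zeroOne : ∀ {n} (f : Network n) (v : Vec ℕ n) → ZeroOne v → ZeroOne (run f v)
run-zeroOne []       v v≤1 = v≤1
run-zeroOne (c ∷ cs) v v≤1 = run-zeroOne cs (applyComp c v) (applyComp-zeroOne c v v≤1)

sum≤-if-zero-from : ∀ {n} (y : Vec ℕ n) m → ZeroOne y →
                    (∀ p → m ≤ toℕ p → lookup y p ≡ 0) → sum y ≤ m
sum≤-if-zero-from []      m       _   _     = z≤n
sum≤-if-zero-from (x ∷ y) zero    y≤1 zeros rewrite zeros F.zero z≤n =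
  sum≤-if-zero-from y zero (λ p → y≤1 (F.suc p)) (λ p _ → zeros (F.suc p) z≤n)
sum≤-if-zero-from (x ∷ y) (suc m) y≤1 zeros =
  +-mono-≤ (y≤1 F.zero)
           (sum≤-if-zero-from y m (λ p → y≤1 (F.suc p)) (λ p m≤p → zeros (F.suc p) (s≤s m≤p)))

selection-output-≤ : ∀ {n k} (f : Network n) → IsSelectionNetwork k f → ∀ x {a q : Fin n} →
                     toℕ a < k → toℕ a ≤ toℕ q → lookup (run f x) q ≤ lookup (run f x) a
selection-output-≤ {k = k} f sel x {a} {q} a<k a≤q with m≤n⇒m<n∨m≡n a≤q
... | inj₂ a≡q rewrite toℕ-injective a≡q = ≤-refl
... | inj₁ a<q with toℕ q <? k
...   | yes q<k = proj₁ (sel x) a q a<q q<k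
...   | no  q≮k = proj₂ (sel x) a q a<k (≮⇒≥ q≮k)

selection-output-positive : ∀ {n k} (f : Network n) → IsSelectionNetwork k f → ∀ x {a : Fin n} →
                            ZeroOne x → toℕ a < k → toℕ a < sum x → 1 ≤ lookup (run f x) a
selection-output-positive f sel x {a} x≤1 a<k a<sum with lookup (run f x) a in ya≡0
... | suc _ = s≤s z≤n
... | zero  = contradiction sum≤a (<⇒≱ a<sum)
  where
    sum≤a : sum x ≤ toℕ a
    sum≤a = subst (_≤ toℕ a) (sum-run f x)
      (sum≤-if-zero-from (run f x) (toℕ a) (run-zeroOne f x x≤1)
        (λ q a≤q → n≤0⇒n≡0 (subst (lookup (run f x) q ≤_) ya≡0 (selection-output-≤ f sel x a<k a≤q))))

module _ (ψ : CNF) (I : Lit → Set) where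

  Propagated : ℕ → ℕ → Set
  Propagated var val = 1 ≤ val → UnitProp ψ I (pos var)

  max-propagated : ∀ {a b c av bv} → (neg a ∷ pos c ∷ []) ∈ₗ ψ → (neg b ∷ pos c ∷ []) ∈ₗ ψ →
                   Propagated a av → Propagated b bv → Propagated c (av ⊔ bv)
  max-propagated {av = zero}  _    b⇒c _     ⊢b 1≤bv = unit b⇒c (there (here refl)) other
    where
      other : ∀ {l} → l ∈ₗ (_ ∷ _ ∷ []) → l ≢ _ → UnitProp ψ I (negate l)
      other (here refl)         _   = ⊢b 1≤bv
      other (there (here refl)) l≢l = contradiction refl l≢l
  max-propagated {av = suc _} a⇒c _    ⊢a    _  _     = unit a⇒c (there (here refl)) other
    where
      other : ∀ {l} → l ∈ₗ (_ ∷ _ ∷ []) → l ≢ _ → UnitProp ψ I (negate l)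
      other (here refl)         _   = ⊢a (s≤s z≤n)
      other (there (here refl)) l≢l = contradiction refl l≢l

  min-propagated : ∀ {a b d av bv} → (neg a ∷ neg b ∷ pos d ∷ []) ∈ₗ ψ →
                   Propagated a av → Propagated b bv → Propagated d (av ⊓ bv)
  min-propagated {av = suc _} {bv = suc _} ab⇒d ⊢a ⊢b _ = unit ab⇒d (there (there (here refl))) other
    where
      other : ∀ {l} → l ∈ₗ (_ ∷ _ ∷ _ ∷ []) → l ≢ _ → UnitProp ψ I (negate l)
      other (here refl)                 _   = ⊢a (s≤s z≤n)
      other (there (here refl))         _   = ⊢b (s≤s z≤n)
      other (there (there (here refl))) l≢l = contradiction refl l≢l

  encodeFrom-propagated : ∀ {n} (f : Network n) (s : Vec ℕ n × ℕ) (v : Vec ℕ n) →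
                          (∀ {C} → C ∈ₗ proj₂ (encodeFrom f s) → C ∈ₗ ψ) →
                          Pointwise Propagated (lookup (proj₁ s)) (lookup v) →
                          Pointwise Propagated (lookup (proj₁ (proj₁ (encodeFrom f s)))) (lookup (run f v))
  encodeFrom-propagated []         s          v _  ⊢v = ⊢v
  encodeFrom-propagated (cmp ∷ cs) (vars , c) v ⊆ψ ⊢v =
    encodeFrom-propagated cs _ (applyComp cmp v) (λ C∈ → ⊆ψ (there (there (there C∈))))
      ([]≔-pointwise Propagated (vars [ i cmp ]≔ c) (v [ i cmp ]≔ _) (j cmp)
        ([]≔-pointwise Propagated vars v (i cmp) ⊢v
          (max-propagated (⊆ψ (here refl)) (⊆ψ (there (here refl))) (⊢v (i cmp)) (⊢v (j cmp))))
        (min-propagated (⊆ψ (there (there (here refl)))) (⊢v (i cmp)) (⊢v (j cmp))))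

bit : Bool → ℕ
bit true  = 1
bit false = 0

sum-bits : ∀ {n} (S : Subset n) → sum (map bit S) ≡ ∣ S ∣
sum-bits []          = refl
sum-bits (true ∷ S)  = cong suc (sum-bits S)
sum-bits (false ∷ S) = sum-bits S

bits-zeroOne : ∀ {n} (S : Subset n) → ZeroOne (map bit S)
bits-zeroOne S p rewrite lookup-map p bit S with lookup S p
... | true  = s≤s z≤n
... | false = z≤n

inputs-propagated : ∀ {n} (ψ : CNF) (S : Subset n) →
                    Pointwise (Propagated ψ (InitTrue (_∈ S))) (lookup (proj₁ initState)) (lookup (map bit S))
inputs-propagated ψ S p rewrite lookup∘tabulate toℕ p | lookup-map p bit S with lookup S p in S[p]
... | true  = λ _ → initial (p , lookup⇒[]= p S S[p] , refl)
... | false = λ ()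

lemma11 : (n k : ℕ) → 1 ≤ k → k ≤ n → (f : Network n) → IsSelectionNetwork k f →
          (S : Subset n) → ∣ S ∣ ≡ k ∸ 1 →
          (a : Fin n) → toℕ a < k ∸ 1 →
          UnitProp (φ f) (InitTrue (λ b → b ∈ S)) (pos (yVar f a))
lemma11 n k _ _ f sel S ∣S∣≡k-1 a a<k-1 =
  encodeFrom-propagated (φ f) (InitTrue (_∈ S)) f initState x (λ C∈ → C∈) (inputs-propagated (φ f) S) a
    (selection-output-positive f sel x (bits-zeroOne S) (<-≤-trans a<k-1 (m∸n≤m k 1)) a<sum)
  where
    x = map bit S
    a<sum : toℕ a < sum x
    a<sum = subst (toℕ a <_) (sym (trans (sum-bits S) ∣S∣≡k-1)) a<k-1
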